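{- Let $D$ be the derivation on the ring of Laurent polynomials in the commuting variables $a,x,y,z$ (over $\mathbb{Q}$) determined by $$D(a)=az,\quad D(z)=xy,\quad D(x)=xy,\quad D(y)=xy,$$ extended by linearity and the Leibniz rule $D(uv)=D(u)v+uD(v)$. For such a Laurent polynomial $w$ set $\mathrm{Gen}(w,t)=\sum_{n\ge 0} D^n(w)\,\frac{t^n}{n!}$. Then, as formal power series in $t$, $$\mathrm{Gen}(a,t)=\sum_{n\ge 0} D^n(a)\frac{t^n}{n!}=\frac{a(y-x)e^{zt}}{y e^{xt}-x e^{yt}}.$$
   Context: $D$ is the "formal derivative" associated with the context-free grammar $\{a\to az,\ z\to xy,\ x\to xy,\ y\to xy\}$; $D^0(w)=w$. -}

module Defs where

open import Data.Nat as ℕ using (ℕ; zero; suc; _!)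
open import Data.Nat.Properties using (_!≢0)
open import Data.Integer as ℤ using (ℤ)
open import Data.Rational as ℚ using (ℚ; 0ℚ; 1ℚ)
open import Data.List using (List; []; _∷_; _++_; map; concatMap; foldr; upTo)
open import Data.Product using (_×_; _,_)
open import Relation.Nullary using (yes; no)
open import Relation.Binary.PropositionalEquality using (_≡_)

record Mono : Set where
  constructor mono
  field
    ea ex ey ez : ℤ

_·ₘ_ : Mono → Mono → Mono
mono i j k l ·ₘ mono i' j' k' l' = mono (i ℤ.+ i') (j ℤ.+ j') (k ℤ.+ k') (l ℤ.+ l')

infix 4 _≟ₘ_
_≟ₘ_ : (m n : Mono) → Relation.Nullary.Dec (m ≡ n)
mono i j k l ≟ₘ mono i' j' k' l' with i ℤ.≟ i' | j ℤ.≟ j' | k ℤ.≟ k' | l ℤ.≟ l'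
... | yes Relation.Binary.PropositionalEquality.refl | yes Relation.Binary.PropositionalEquality.refl
    | yes Relation.Binary.PropositionalEquality.refl | yes Relation.Binary.PropositionalEquality.refl
    = yes Relation.Binary.PropositionalEquality.refl
... | no p | _ | _ | _ = no λ { Relation.Binary.PropositionalEquality.refl → p Relation.Binary.PropositionalEquality.refl }
... | yes _ | no p | _ | _ = no λ { Relation.Binary.PropositionalEquality.refl → p Relation.Binary.PropositionalEquality.refl }
... | yes _ | yes _ | no p | _ = no λ { Relation.Binary.PropositionalEquality.refl → p Relation.Binary.PropositionalEquality.refl }
... | yes _ | yes _ | yes _ | no p = no λ { Relation.Binary.PropositionalEquality.refl → p Relation.Binary.PropositionalEquality.refl }

-- A Laurent polynomial is a finite formal sum of terms c · m.
-- (Representation; polynomials are compared through their coefficients.)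
Poly : Set
Poly = List (ℚ × Mono)

coeff : Poly → Mono → ℚ
coeff [] m = 0ℚ
coeff ((c , n) ∷ p) m with n ≟ₘ m
... | yes _ = c ℚ.+ coeff p m
... | no _  = coeff p m

infix 4 _≈ₚ_
_≈ₚ_ : Poly → Poly → Set
p ≈ₚ q = ∀ m → coeff p m ≡ coeff q m

monoOne : Mono
monoOne = mono (ℤ.+ 0) (ℤ.+ 0) (ℤ.+ 0) (ℤ.+ 0)

const : ℚ → Poly
const c = (c , monoOne) ∷ []

zeroₚ oneₚ : Poly
zeroₚ = []
oneₚ = const 1ℚ

aP xP yP zP : Poly
aP = (1ℚ , mono (ℤ.+ 1) (ℤ.+ 0) (ℤ.+ 0) (ℤ.+ 0)) ∷ []
xP = (1ℚ , mono (ℤ.+ 0) (ℤ.+ 1) (ℤ.+ 0) (ℤ.+ 0)) ∷ []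
yP = (1ℚ , mono (ℤ.+ 0) (ℤ.+ 0) (ℤ.+ 1) (ℤ.+ 0)) ∷ []
zP = (1ℚ , mono (ℤ.+ 0) (ℤ.+ 0) (ℤ.+ 0) (ℤ.+ 1)) ∷ []

infixl 6 _+ₚ_ _-ₚ_
infixl 7 _*ₚ_ _·ₚ_

_+ₚ_ : Poly → Poly → Poly
p +ₚ q = p ++ q

_·ₚ_ : ℚ → Poly → Poly
c ·ₚ p = map (λ { (d , m) → (c ℚ.* d , m) }) p

_-ₚ_ : Poly → Poly → Poly
p -ₚ q = p +ₚ (ℚ.- 1ℚ) ·ₚ q

_*ₚ_ : Poly → Poly → Poly
p *ₚ q = concatMap (λ { (c , m) → map (λ { (d , n) → (c ℚ.* d , m ·ₘ n) }) q }) p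

_^ₚ_ : Poly → ℕ → Poly
p ^ₚ zero = oneₚ
p ^ₚ suc n = p *ₚ (p ^ₚ n)

sumₚ : List Poly → Poly
sumₚ = foldr _+ₚ_ zeroₚ

-- By linearity and the Leibniz rule (for integer exponents, D(u^e) = e u^(e-1) D u),
-- on a monomial m = a^i x^j y^k z^l it acts as
--   D m = i·m·z + j·m·y + k·m·x + l·m·x·y·z⁻¹ .

ℤtoℚ : ℤ → ℚ
ℤtoℚ i = i ℚ./ 1

Dterm : ℚ × Mono → Poly
Dterm (c , m@(mono i j k l)) =
    (c ℚ.* ℤtoℚ i , m ·ₘ mono (ℤ.+ 0) (ℤ.+ 0) (ℤ.+ 0) (ℤ.+ 1))
  ∷ (c ℚ.* ℤtoℚ j , m ·ₘ mono (ℤ.+ 0) (ℤ.+ 0) (ℤ.+ 1) (ℤ.+ 0))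
  ∷ (c ℚ.* ℤtoℚ k , m ·ₘ mono (ℤ.+ 0) (ℤ.+ 1) (ℤ.+ 0) (ℤ.+ 0))
  ∷ (c ℚ.* ℤtoℚ l , m ·ₘ mono (ℤ.+ 0) (ℤ.+ 1) (ℤ.+ 1) (ℤ.-[1+ 0 ]))
  ∷ []

D : Poly → Poly
D p = concatMap Dterm p

D^ : ℕ → Poly → Poly
D^ zero w = w
D^ (suc n) w = D (D^ n w)

-- Formal power series in t with Laurent polynomial coefficients:
-- f represents Σ_n f(n) tⁿ.

PS : Set
PS = ℕ → Poly

infix 4 _≈ₛ_
_≈ₛ_ : PS → PS → Set
f ≈ₛ g = ∀ n → f n ≈ₚ g n

1/fact : ℕ → ℚ
1/fact n = (ℤ.+ 1) ℚ./ (n !)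
  where instance _ = n !≢0

Gen : Poly → PS
Gen w n = 1/fact n ·ₚ D^ n w

expS : Poly → PS
expS p n = 1/fact n ·ₚ (p ^ₚ n)

_·ₛ_ : Poly → PS → PS
(p ·ₛ f) n = p *ₚ f n

_-ₛ_ : PS → PS → PS
(f -ₛ g) n = f n -ₚ g n

_*ₛ_ : PS → PS → PS
(f *ₛ g) n = sumₚ (map (λ k → f k *ₚ g (n ℕ.∸ k)) (upTo (suc n)))

infixl 7 _·ₛ_ _*ₛ_
infixl 6 _-ₛ_

-- Since D is a derivation, w ↦ Gen w is multiplicative, and D u = c u with D c = 0 gives
-- Gen u = u e^{ct}. Write a = (a/x)·x and y = (y/x)·x: as D(a/x) = (z − y)·a/x and
-- D(y/x) = (x − y)·y/x, with X = Gen x we get Gen a = (a/x) e^{(z−y)t} X and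
-- Gen y = (y/x) e^{(x−y)t} X, while D x = D y gives X = Gen y + (x − y). Eliminating Gen y,
-- (y e^{(x−y)t} − x) X = x (y − x); multiplying by e^{yt} turns the first factor into
-- y e^{xt} − x e^{yt}, so Gen a · (y e^{xt} − x e^{yt}) = (a/x) e^{zt} · x (y − x).
-- The identities Gen (u v) = Gen u Gen v, Gen u = u e^{ct} and e^{st} e^{rt} = e^{(s+r)t} hold
-- because both sides solve the same equation h′ = φ(h) with the same h(0).

{-# OPTIONS --safe #-}
module Submission where

open import Defs
open import Algebra.Bundles using (AbelianGroup; CommutativeMonoid; CommutativeSemigroup)
import Algebra.Properties.CommutativeSemigroup as CommutativeSemigroupProperties
import Algebra.Solver.CommutativeMonoid as CommutativeMonoidSolver
open import Data.Empty using (⊥-elim)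
open import Data.Integer as ℤ using (ℤ; +_)
import Data.Integer.Properties as ℤP
open import Algebra.Properties.Group (AbelianGroup.group ℤP.+-0-abelianGroup)
  using (//-rightDividesˡ; //-rightDividesʳ)
open import Data.List using (List; []; _∷_; _++_; map; applyUpTo)
open import Data.List.Membership.Propositional using (_∉_)
open import Data.List.Membership.Propositional.Properties using (∈-++⁺ˡ; ∈-++⁺ʳ)
open import Data.List.Membership.DecPropositional _≟ₘ_ using (_∈?_)
import Data.List.Properties as List
open import Data.List.Relation.Unary.All as All using (all?)
open import Data.List.Relation.Unary.Any using (here; there)
open import Data.Nat as ℕ using (ℕ; zero; suc; _!)
import Data.Nat.Properties as ℕP
open import Data.Product using (_×_; _,_; proj₂)
open import Data.Rational as ℚ using (ℚ; 0ℚ; 1ℚ)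
import Data.Rational.Properties as ℚP
open import Data.Rational.Solver using (module +-*-Solver)
import Data.Rational.Unnormalised as ℚᵘ
import Data.Rational.Unnormalised.Properties as ℚᵘP
open import Function using (_∘_)
open import Relation.Binary using (Setoid)
open import Relation.Binary.PropositionalEquality
import Relation.Binary.Reasoning.Setoid as SetoidReasoning
open import Relation.Nullary using (yes; no)
open import Relation.Nullary.Decidable using (True; toWitness)

open +-*-Solver

toℚᵘ-/ : ∀ i d .{{_ : ℕ.NonZero d}} → ℚ.toℚᵘ (i ℚ./ d) ℚᵘ.≃ (i ℚᵘ./ d)
toℚᵘ-/ i (suc d) = ℚP.toℚᵘ-fromℚᵘ (ℚᵘ.mkℚᵘ i d)

ℤtoℚ-+ : ∀ i j → ℤtoℚ (i ℤ.+ j) ≡ ℤtoℚ i ℚ.+ ℤtoℚ j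
ℤtoℚ-+ i j = ℚP.toℚᵘ-injective (begin
  ℚ.toℚᵘ (ℤtoℚ (i ℤ.+ j))                ≈⟨ toℚᵘ-/ (i ℤ.+ j) 1 ⟩
  ℚᵘ.mkℚᵘ (i ℤ.+ j) 0                    ≈⟨ ℚᵘ.*≡* (cong (ℤ._* + 1) (sym (cong₂ ℤ._+_ (ℤP.*-identityʳ i) (ℤP.*-identityʳ j)))) ⟩
  ℚᵘ.mkℚᵘ i 0 ℚᵘ.+ ℚᵘ.mkℚᵘ j 0            ≈⟨ ℚᵘP.+-cong (toℚᵘ-/ i 1) (toℚᵘ-/ j 1) ⟨
  ℚ.toℚᵘ (ℤtoℚ i) ℚᵘ.+ ℚ.toℚᵘ (ℤtoℚ j)    ≈⟨ ℚP.toℚᵘ-homo-+ (ℤtoℚ i) (ℤtoℚ j) ⟨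
  ℚ.toℚᵘ (ℤtoℚ i ℚ.+ ℤtoℚ j)              ∎)
  where open ℚᵘP.≃-Reasoning

ℕtoℚ : ℕ → ℚ
ℕtoℚ n = ℤtoℚ (+ n)

ℕtoℚ-*-1/ : ∀ m d e .{{_ : ℕ.NonZero d}} .{{_ : ℕ.NonZero e}} → m ℕ.* e ≡ d →
            ℕtoℚ m ℚ.* (+ 1 ℚ./ d) ≡ + 1 ℚ./ e
ℕtoℚ-*-1/ m (suc d) (suc e) m*e≡d = ℚP.toℚᵘ-injective (begin
  ℚ.toℚᵘ (ℕtoℚ m ℚ.* (+ 1 ℚ./ suc d))              ≈⟨ ℚP.toℚᵘ-homo-* (ℕtoℚ m) (+ 1 ℚ./ suc d) ⟩
  ℚ.toℚᵘ (ℕtoℚ m) ℚᵘ.* ℚ.toℚᵘ (+ 1 ℚ./ suc d)      ≈⟨ ℚᵘP.*-cong (toℚᵘ-/ (+ m) 1) (toℚᵘ-/ (+ 1) (suc d)) ⟩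
  ℚᵘ.mkℚᵘ (+ m) 0 ℚᵘ.* ℚᵘ.mkℚᵘ (+ 1) d              ≈⟨ ℚᵘ.*≡* cross ⟩
  ℚᵘ.mkℚᵘ (+ 1) e                                   ≈⟨ toℚᵘ-/ (+ 1) (suc e) ⟨
  ℚ.toℚᵘ (+ 1 ℚ./ suc e)                            ∎)
  where
  open ℚᵘP.≃-Reasoning
  cross : (+ m ℤ.* + 1) ℤ.* + suc e ≡ + 1 ℤ.* + (1 ℕ.* suc d)
  cross = trans (cong (ℤ._* + suc e) (ℤP.*-identityʳ (+ m)))
         (trans (sym (ℤP.pos-* m (suc e)))
         (trans (cong +_ (trans m*e≡d (sym (ℕP.*-identityˡ (suc d))))) (sym (ℤP.*-identityˡ _))))

mono-≡ : ∀ {i i′ j j′ k k′ l l′} → i ≡ i′ → j ≡ j′ → k ≡ k′ → l ≡ l′ →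
         mono i j k l ≡ mono i′ j′ k′ l′
mono-≡ refl refl refl refl = refl

infix 30 _⁻¹ₘ
_⁻¹ₘ : Mono → Mono
mono i j k l ⁻¹ₘ = mono (ℤ.- i) (ℤ.- j) (ℤ.- k) (ℤ.- l)

·ₘ-comm : ∀ m n → m ·ₘ n ≡ n ·ₘ m
·ₘ-comm (mono i j k l) (mono i′ j′ k′ l′) =
  mono-≡ (ℤP.+-comm i i′) (ℤP.+-comm j j′) (ℤP.+-comm k k′) (ℤP.+-comm l l′)

·ₘ-assoc : ∀ m n o → (m ·ₘ n) ·ₘ o ≡ m ·ₘ (n ·ₘ o)
·ₘ-assoc (mono i j k l) (mono i′ j′ k′ l′) (mono a b c d) =
  mono-≡ (ℤP.+-assoc i i′ a) (ℤP.+-assoc j j′ b) (ℤP.+-assoc k k′ c) (ℤP.+-assoc l l′ d)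

·ₘ-identityˡ : ∀ m → monoOne ·ₘ m ≡ m
·ₘ-identityˡ (mono i j k l) =
  mono-≡ (ℤP.+-identityˡ i) (ℤP.+-identityˡ j) (ℤP.+-identityˡ k) (ℤP.+-identityˡ l)

[m·u]·u⁻¹≡m : ∀ m u → (m ·ₘ u) ·ₘ u ⁻¹ₘ ≡ m
[m·u]·u⁻¹≡m (mono i j k l) (mono a b c d) =
  mono-≡ (//-rightDividesʳ a i) (//-rightDividesʳ b j) (//-rightDividesʳ c k) (//-rightDividesʳ d l)

[m·u⁻¹]·u≡m : ∀ m u → (m ·ₘ u ⁻¹ₘ) ·ₘ u ≡ m
[m·u⁻¹]·u≡m (mono i j k l) (mono a b c d) =
  mono-≡ (//-rightDividesˡ a i) (//-rightDividesˡ b j) (//-rightDividesˡ c k) (//-rightDividesˡ d l)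

-- Laurent polynomials up to equality of coefficients

-- _≈ₚ_ unfolds to a function type from which p and q cannot be inferred; the record keeps them.
infix 4 _≋_
record _≋_ (p q : Poly) : Set where
  constructor ⟨_⟩
  field coeff-≡ : p ≈ₚ q
open _≋_

≋-refl : ∀ {p} → p ≋ p
≋-refl = ⟨ (λ _ → refl) ⟩

≋-sym : ∀ {p q} → p ≋ q → q ≋ p
≋-sym ⟨ e ⟩ = ⟨ (λ m → sym (e m)) ⟩

≋-trans : ∀ {p q r} → p ≋ q → q ≋ r → p ≋ r
≋-trans ⟨ e ⟩ ⟨ f ⟩ = ⟨ (λ m → trans (e m) (f m)) ⟩

≡⇒≋ : ∀ {p q} → p ≡ q → p ≋ q
≡⇒≋ refl = ≋-refl

≋-setoid : Setoid _ _
≋-setoid = record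
  { Carrier = Poly ; _≈_ = _≋_
  ; isEquivalence = record { refl = ≋-refl ; sym = ≋-sym ; trans = ≋-trans } }

module ≋-Reasoning = SetoidReasoning ≋-setoid

coeff-+ : ∀ p q m → coeff (p +ₚ q) m ≡ coeff p m ℚ.+ coeff q m
coeff-+ [] q m = sym (ℚP.+-identityˡ _)
coeff-+ ((c , n) ∷ p) q m with n ≟ₘ m
... | yes _ = trans (cong (c ℚ.+_) (coeff-+ p q m)) (sym (ℚP.+-assoc c _ _))
... | no _  = coeff-+ p q m

+-cong : ∀ {p p′ q q′} → p ≋ p′ → q ≋ q′ → p +ₚ q ≋ p′ +ₚ q′
+-cong {p} {p′} {q} {q′} ⟨ e ⟩ ⟨ f ⟩ = ⟨ (λ m → begin
  coeff (p +ₚ q) m             ≡⟨ coeff-+ p q m ⟩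
  coeff p m ℚ.+ coeff q m      ≡⟨ cong₂ ℚ._+_ (e m) (f m) ⟩
  coeff p′ m ℚ.+ coeff q′ m    ≡⟨ coeff-+ p′ q′ m ⟨
  coeff (p′ +ₚ q′) m           ∎) ⟩
  where open ≡-Reasoning

+-congˡ : ∀ p {q q′} → q ≋ q′ → p +ₚ q ≋ p +ₚ q′
+-congˡ p = +-cong (≋-refl {p})

+-congʳ : ∀ {p p′} q → p ≋ p′ → p +ₚ q ≋ p′ +ₚ q
+-congʳ q e = +-cong e (≋-refl {q})

+-comm : ∀ p q → p +ₚ q ≋ q +ₚ p
+-comm p q = ⟨ (λ m → trans (coeff-+ p q m) (trans (ℚP.+-comm (coeff p m) _) (sym (coeff-+ q p m)))) ⟩

+-identityʳ : ∀ p → p +ₚ zeroₚ ≋ p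
+-identityʳ p = ≡⇒≋ (List.++-identityʳ p)

+-commutativeMonoid : CommutativeMonoid _ _
+-commutativeMonoid = record
  { Carrier = Poly ; _≈_ = _≋_ ; _∙_ = _+ₚ_ ; ε = zeroₚ
  ; isCommutativeMonoid = record
    { isMonoid = record
      { isSemigroup = record
        { isMagma = record { isEquivalence = Setoid.isEquivalence ≋-setoid ; ∙-cong = +-cong }
        ; assoc = λ p q r → ≡⇒≋ (List.++-assoc p q r) }
      ; identity = (λ _ → ≋-refl) , +-identityʳ }
    ; comm = +-comm } }

open CommutativeSemigroupProperties (CommutativeMonoid.commutativeSemigroup +-commutativeMonoid)
  using (interchange)
open CommutativeMonoidSolver +-commutativeMonoid using (_⊕_; _⊜_) renaming (solve to CM-solve)

coeff-· : ∀ c p m → coeff (c ·ₚ p) m ≡ c ℚ.* coeff p m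
coeff-· c [] m = sym (ℚP.*-zeroʳ c)
coeff-· c ((d , n) ∷ p) m with n ≟ₘ m
... | yes _ = trans (cong (c ℚ.* d ℚ.+_) (coeff-· c p m)) (sym (ℚP.*-distribˡ-+ c d _))
... | no _  = coeff-· c p m

·-cong : ∀ c {p q} → p ≋ q → c ·ₚ p ≋ c ·ₚ q
·-cong c {p} {q} ⟨ e ⟩ = ⟨ (λ m → trans (coeff-· c p m) (trans (cong (c ℚ.*_) (e m)) (sym (coeff-· c q m)))) ⟩

·-distribˡ-+ : ∀ c p q → c ·ₚ (p +ₚ q) ≡ c ·ₚ p +ₚ c ·ₚ q
·-distribˡ-+ c p q = List.map-++ _ p q

·-distribʳ-+ : ∀ c d p → (c ℚ.+ d) ·ₚ p ≋ c ·ₚ p +ₚ d ·ₚ p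
·-distribʳ-+ c d p = ⟨ (λ m → begin
  coeff ((c ℚ.+ d) ·ₚ p) m                  ≡⟨ coeff-· (c ℚ.+ d) p m ⟩
  (c ℚ.+ d) ℚ.* coeff p m                   ≡⟨ ℚP.*-distribʳ-+ (coeff p m) c d ⟩
  c ℚ.* coeff p m ℚ.+ d ℚ.* coeff p m       ≡⟨ cong₂ ℚ._+_ (coeff-· c p m) (coeff-· d p m) ⟨
  coeff (c ·ₚ p) m ℚ.+ coeff (d ·ₚ p) m     ≡⟨ coeff-+ (c ·ₚ p) (d ·ₚ p) m ⟨
  coeff (c ·ₚ p +ₚ d ·ₚ p) m                ∎) ⟩
  where open ≡-Reasoning

·-assoc : ∀ c d p → c ·ₚ (d ·ₚ p) ≋ (c ℚ.* d) ·ₚ p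
·-assoc c d p = ⟨ (λ m → begin
  coeff (c ·ₚ (d ·ₚ p)) m       ≡⟨ coeff-· c (d ·ₚ p) m ⟩
  c ℚ.* coeff (d ·ₚ p) m        ≡⟨ cong (c ℚ.*_) (coeff-· d p m) ⟩
  c ℚ.* (d ℚ.* coeff p m)       ≡⟨ ℚP.*-assoc c d (coeff p m) ⟨
  (c ℚ.* d) ℚ.* coeff p m       ≡⟨ coeff-· (c ℚ.* d) p m ⟨
  coeff ((c ℚ.* d) ·ₚ p) m      ∎) ⟩
  where open ≡-Reasoning

·-identityˡ : ∀ p → 1ℚ ·ₚ p ≋ p
·-identityˡ p = ⟨ (λ m → trans (coeff-· 1ℚ p m) (ℚP.*-identityˡ _)) ⟩

·-zeroˡ : ∀ p → 0ℚ ·ₚ p ≋ zeroₚ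
·-zeroˡ p = ⟨ (λ m → trans (coeff-· 0ℚ p m) (ℚP.*-zeroˡ (coeff p m))) ⟩

-ₚ-inverseʳ : ∀ p → p -ₚ p ≋ zeroₚ
-ₚ-inverseʳ p = ⟨ (λ m → begin
  coeff (p -ₚ p) m                          ≡⟨ coeff-+ p _ m ⟩
  coeff p m ℚ.+ coeff ((ℚ.- 1ℚ) ·ₚ p) m     ≡⟨ cong (coeff p m ℚ.+_) (coeff-· (ℚ.- 1ℚ) p m) ⟩
  coeff p m ℚ.+ (ℚ.- 1ℚ) ℚ.* coeff p m      ≡⟨ solve 1 (λ a → a :+ (:- con 1ℚ) :* a := con 0ℚ) refl (coeff p m) ⟩
  0ℚ                                        ∎) ⟩
  where open ≡-Reasoning

-ₚ-+-cancel : ∀ p q → p -ₚ (p +ₚ q) ≋ (ℚ.- 1ℚ) ·ₚ q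
-ₚ-+-cancel p q = ≋-trans (+-congˡ p (≡⇒≋ (·-distribˡ-+ (ℚ.- 1ℚ) p q)))
  (≋-trans (≋-sym (≡⇒≋ (List.++-assoc p ((ℚ.- 1ℚ) ·ₚ p) ((ℚ.- 1ℚ) ·ₚ q))))
           (+-congʳ ((ℚ.- 1ℚ) ·ₚ q) (-ₚ-inverseʳ p)))

shift : (Mono → ℚ) → Mono → Poly → Poly
shift w u = map (λ { (c , n) → (c ℚ.* w n , n ·ₘ u) })

coeff-shift : ∀ w u p m → coeff (shift w u p) m ≡ coeff p (m ·ₘ u ⁻¹ₘ) ℚ.* w (m ·ₘ u ⁻¹ₘ)
coeff-shift w u [] m = sym (ℚP.*-zeroˡ (w (m ·ₘ u ⁻¹ₘ)))
coeff-shift w u ((c , n) ∷ p) m with n ·ₘ u ≟ₘ m | n ≟ₘ m ·ₘ u ⁻¹ₘ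
... | yes _       | yes refl   = trans (cong (c ℚ.* w n ℚ.+_) (coeff-shift w u p m))
                                     (sym (ℚP.*-distribʳ-+ (w n) c _))
... | yes n·u≡m   | no n≢m·u⁻¹ = ⊥-elim (n≢m·u⁻¹ (trans (sym ([m·u]·u⁻¹≡m n u)) (cong (_·ₘ u ⁻¹ₘ) n·u≡m)))
... | no n·u≢m    | yes refl   = ⊥-elim (n·u≢m ([m·u⁻¹]·u≡m m u))
... | no _        | no _       = coeff-shift w u p m

shift-cong : ∀ w u {p q} → p ≋ q → shift w u p ≋ shift w u q
shift-cong w u {p} {q} ⟨ e ⟩ = ⟨ (λ m → begin
  coeff (shift w u p) m                          ≡⟨ coeff-shift w u p m ⟩
  coeff p (m ·ₘ u ⁻¹ₘ) ℚ.* w (m ·ₘ u ⁻¹ₘ)        ≡⟨ cong (ℚ._* w (m ·ₘ u ⁻¹ₘ)) (e _) ⟩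
  coeff q (m ·ₘ u ⁻¹ₘ) ℚ.* w (m ·ₘ u ⁻¹ₘ)        ≡⟨ coeff-shift w u q m ⟨
  coeff (shift w u q) m                          ∎) ⟩
  where open ≡-Reasoning

Term : Set
Term = ℚ × Mono

infixl 7 _⊙_
_⊙_ : Term → Term → Term
(c , m) ⊙ (d , n) = (c ℚ.* d , m ·ₘ n)

infixr 7 _◃_
_◃_ : Term → Poly → Poly
t ◃ q = map (t ⊙_) q

◃-shift : ∀ c u q → (c , u) ◃ q ≡ shift (λ _ → c) u q
◃-shift c u = List.map-cong (λ { (d , n) → cong₂ _,_ (ℚP.*-comm c d) (·ₘ-comm u n) })

◃-cong : ∀ t {q q′} → q ≋ q′ → t ◃ q ≋ t ◃ q′
◃-cong (c , u) {q} {q′} e = ≋-trans (≡⇒≋ (◃-shift c u q))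
  (≋-trans (shift-cong (λ _ → c) u e) (≡⇒≋ (sym (◃-shift c u q′))))

◃-distrib-+ : ∀ t p q → t ◃ (p +ₚ q) ≡ t ◃ p +ₚ t ◃ q
◃-distrib-+ t = List.map-++ (t ⊙_)

◃-◃ : ∀ t s r → t ◃ s ◃ r ≡ (t ⊙ s) ◃ r
◃-◃ (c , u) (d , v) r = trans (sym (List.map-∘ r))
  (List.map-cong (λ { (e , w) → cong₂ _,_ (sym (ℚP.*-assoc c d e)) (sym (·ₘ-assoc u v w)) }) r)

◃-· : ∀ c t q → t ◃ (c ·ₚ q) ≡ c ·ₚ (t ◃ q)
◃-· c (d , u) q = trans (sym (List.map-∘ q)) (trans (List.map-cong (λ { (e , w) →
  cong (_, u ·ₘ w) (solve 3 (λ c d e → d :* (c :* e) := c :* (d :* e)) refl c d e) }) q) (List.map-∘ q))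

*-congˡ : ∀ p {q q′} → q ≋ q′ → p *ₚ q ≋ p *ₚ q′
*-congˡ []      e = ≋-refl
*-congˡ (t ∷ p) e = +-cong (◃-cong t e) (*-congˡ p e)

*-distribʳ-+ : ∀ p q r → (p +ₚ q) *ₚ r ≡ p *ₚ r +ₚ q *ₚ r
*-distribʳ-+ p q r = List.concatMap-++ (_◃ r) p q

*-distribˡ-+ : ∀ r p q → r *ₚ (p +ₚ q) ≋ r *ₚ p +ₚ r *ₚ q
*-distribˡ-+ []      p q = ≋-refl
*-distribˡ-+ (t ∷ r) p q = begin
  t ◃ (p +ₚ q) +ₚ r *ₚ (p +ₚ q)            ≈⟨ +-cong (≡⇒≋ (◃-distrib-+ t p q)) (*-distribˡ-+ r p q) ⟩
  (t ◃ p +ₚ t ◃ q) +ₚ (r *ₚ p +ₚ r *ₚ q)   ≈⟨ interchange (t ◃ p) (t ◃ q) (r *ₚ p) (r *ₚ q) ⟩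
  (t ◃ p +ₚ r *ₚ p) +ₚ (t ◃ q +ₚ r *ₚ q)   ∎
  where open ≋-Reasoning

*-zeroʳ : ∀ p → p *ₚ zeroₚ ≡ zeroₚ
*-zeroʳ []      = refl
*-zeroʳ (t ∷ p) = *-zeroʳ p

*-singletonʳ : ∀ t q → q *ₚ (t ∷ []) ≡ t ◃ q
*-singletonʳ (c , u) []            = refl
*-singletonʳ (c , u) ((d , n) ∷ q) =
  cong₂ _∷_ (cong₂ _,_ (ℚP.*-comm d c) (·ₘ-comm n u)) (*-singletonʳ (c , u) q)

*-comm : ∀ p q → p *ₚ q ≋ q *ₚ p
*-comm []      q = ≡⇒≋ (sym (*-zeroʳ q))
*-comm (t ∷ p) q = begin
  t ◃ q +ₚ p *ₚ q                 ≈⟨ +-cong (≡⇒≋ (sym (*-singletonʳ t q))) (*-comm p q) ⟩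
  q *ₚ (t ∷ []) +ₚ q *ₚ p         ≈⟨ *-distribˡ-+ q (t ∷ []) p ⟨
  q *ₚ (t ∷ p)                    ∎
  where open ≋-Reasoning

*-congʳ : ∀ {p p′} q → p ≋ p′ → p *ₚ q ≋ p′ *ₚ q
*-congʳ {p} {p′} q e = ≋-trans (*-comm p q) (≋-trans (*-congˡ q e) (*-comm q p′))

*-cong : ∀ {p p′ q q′} → p ≋ p′ → q ≋ q′ → p *ₚ q ≋ p′ *ₚ q′
*-cong {p′ = p′} {q = q} e f = ≋-trans (*-congʳ q e) (*-congˡ p′ f)

◃-* : ∀ t q r → (t ◃ q) *ₚ r ≡ t ◃ (q *ₚ r)
◃-* t []      r = refl
◃-* t (s ∷ q) r = begin
  (t ⊙ s) ◃ r +ₚ (t ◃ q) *ₚ r       ≡⟨ cong₂ _+ₚ_ (sym (◃-◃ t s r)) (◃-* t q r) ⟩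
  t ◃ s ◃ r +ₚ t ◃ (q *ₚ r)         ≡⟨ ◃-distrib-+ t (s ◃ r) (q *ₚ r) ⟨
  t ◃ (s ◃ r +ₚ q *ₚ r)             ∎
  where open ≡-Reasoning

*-assoc : ∀ p q r → (p *ₚ q) *ₚ r ≡ p *ₚ (q *ₚ r)
*-assoc []      q r = refl
*-assoc (t ∷ p) q r = trans (*-distribʳ-+ (t ◃ q) (p *ₚ q) r) (cong₂ _+ₚ_ (◃-* t q r) (*-assoc p q r))

*-identityˡ : ∀ p → oneₚ *ₚ p ≋ p
*-identityˡ p = ≡⇒≋ (trans (List.++-identityʳ _) (trans
  (List.map-cong (λ { (d , n) → cong₂ _,_ (ℚP.*-identityˡ d) (·ₘ-identityˡ n) }) p) (List.map-id p)))

*-identityʳ : ∀ p → p *ₚ oneₚ ≋ p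
*-identityʳ p = ≋-trans (*-comm p oneₚ) (*-identityˡ p)

*-·ʳ : ∀ c p q → p *ₚ (c ·ₚ q) ≋ c ·ₚ (p *ₚ q)
*-·ʳ c []      q = ≋-refl
*-·ʳ c (t ∷ p) q = ≋-trans (+-cong (≡⇒≋ (◃-· c t q)) (*-·ʳ c p q))
                           (≡⇒≋ (sym (·-distribˡ-+ c (t ◃ q) (p *ₚ q))))

*-·ˡ : ∀ c p q → (c ·ₚ p) *ₚ q ≋ c ·ₚ (p *ₚ q)
*-·ˡ c p q = ≋-trans (*-comm (c ·ₚ p) q) (≋-trans (*-·ʳ c q p) (·-cong c (*-comm q p)))

0·-*-zero : ∀ p q → (0ℚ ·ₚ p) *ₚ q ≋ zeroₚ
0·-*-zero p q = ≋-trans (*-·ˡ 0ℚ p q) (·-zeroˡ (p *ₚ q))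

*-0·-zero : ∀ p q → p *ₚ (0ℚ ·ₚ q) ≋ zeroₚ
*-0·-zero p q = ≋-trans (*-·ʳ 0ℚ p q) (·-zeroˡ (p *ₚ q))

monos : Poly → List Mono
monos = map proj₂

coeff-∉ : ∀ p {m} → m ∉ monos p → coeff p m ≡ 0ℚ
coeff-∉ []            m∉ = refl
coeff-∉ ((c , n) ∷ p) {m} m∉ with n ≟ₘ m
... | yes refl = ⊥-elim (m∉ (here refl))
... | no _     = coeff-∉ p (m∉ ∘ there)

-- Coefficients need only be compared at the monomials occurring in p or q.
by-evaluation : ∀ {p q} {_ : True (all? (λ m → coeff p m ℚP.≟ coeff q m) (monos p ++ monos q))} → p ≋ q
by-evaluation {p} {q} {agree} = ⟨ coeffs-agree ⟩
  where
  coeffs-agree : p ≈ₚ q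
  coeffs-agree m with m ∈? monos p ++ monos q
  ... | yes m∈ = All.lookup (toWitness agree) m∈
  ... | no m∉  = trans (coeff-∉ p (m∉ ∘ ∈-++⁺ˡ)) (sym (coeff-∉ q (m∉ ∘ ∈-++⁺ʳ (monos p))))

-- Derivations

record IsDerivation (d : Poly → Poly) : Set where
  field
    resp-≋  : ∀ {p q} → p ≋ q → d p ≋ d q
    leibniz : ∀ p q → d (p *ₚ q) ≋ d p *ₚ q +ₚ p *ₚ d q

isDerivation-resp : ∀ {d d′} → (∀ p → d p ≋ d′ p) → IsDerivation d → IsDerivation d′
isDerivation-resp {d} {d′} d≋d′ δ = record
  { resp-≋  = λ {p} {q} p≋q → ≋-trans (≋-sym (d≋d′ p)) (≋-trans (resp-≋ p≋q) (d≋d′ q))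
  ; leibniz = λ p q → ≋-trans (≋-sym (d≋d′ (p *ₚ q)))
                      (≋-trans (leibniz p q) (+-cong (*-congʳ q (d≋d′ p)) (*-congˡ p (d≋d′ q))))
  }
  where open IsDerivation δ

+-isDerivation : ∀ {d d′} → IsDerivation d → IsDerivation d′ → IsDerivation (λ p → d p +ₚ d′ p)
+-isDerivation {d} {d′} δ δ′ = record
  { resp-≋  = λ p≋q → +-cong (IsDerivation.resp-≋ δ p≋q) (IsDerivation.resp-≋ δ′ p≋q)
  ; leibniz = λ p q → begin
      d (p *ₚ q) +ₚ d′ (p *ₚ q)
        ≈⟨ +-cong (IsDerivation.leibniz δ p q) (IsDerivation.leibniz δ′ p q) ⟩
      (d p *ₚ q +ₚ p *ₚ d q) +ₚ (d′ p *ₚ q +ₚ p *ₚ d′ q)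
        ≈⟨ interchange (d p *ₚ q) (p *ₚ d q) (d′ p *ₚ q) (p *ₚ d′ q) ⟩
      (d p *ₚ q +ₚ d′ p *ₚ q) +ₚ (p *ₚ d q +ₚ p *ₚ d′ q)
        ≈⟨ +-cong (≡⇒≋ (sym (*-distribʳ-+ (d p) (d′ p) q))) (≋-sym (*-distribˡ-+ p (d q) (d′ q))) ⟩
      (d p +ₚ d′ p) *ₚ q +ₚ p *ₚ (d q +ₚ d′ q)
        ∎
  }
  where open ≋-Reasoning

-- For e the exponent of a variable v, euler e u is the derivation u·v·∂/∂v; D is the sum of four of them.
euler : (Mono → ℤ) → Mono → Poly → Poly
euler e u = shift (ℤtoℚ ∘ e) u

merge-terms : ∀ c d m → (c , m) ∷ (d , m) ∷ [] ≋ (c ℚ.+ d , m) ∷ []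
merge-terms c d m = ≋-trans
  (≡⇒≋ (cong₂ (λ a b → (a , m) ∷ (b , m) ∷ []) (sym (ℚP.*-identityʳ c)) (sym (ℚP.*-identityʳ d))))
  (≋-trans (≋-sym (·-distribʳ-+ c d ((1ℚ , m) ∷ [])))
           (≡⇒≋ (cong (λ a → (a , m) ∷ []) (ℚP.*-identityʳ (c ℚ.+ d)))))

module _ (e : Mono → ℤ) (u : Mono) (e-additive : ∀ m n → e (m ·ₘ n) ≡ e m ℤ.+ e n) where

  private
    w : Mono → ℚ
    w = ℤtoℚ ∘ e

  euler-coefficient : ∀ c d m n → (c ℚ.* w m) ℚ.* d ℚ.+ c ℚ.* (d ℚ.* w n) ≡ (c ℚ.* d) ℚ.* w (m ·ₘ n)
  euler-coefficient c d m n = begin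
    (c ℚ.* w m) ℚ.* d ℚ.+ c ℚ.* (d ℚ.* w n)
      ≡⟨ solve 4 (λ c d a b → (c :* a) :* d :+ c :* (d :* b) := (c :* d) :* (a :+ b)) refl c d (w m) (w n) ⟩
    (c ℚ.* d) ℚ.* (w m ℚ.+ w n)
      ≡⟨ cong ((c ℚ.* d) ℚ.*_) (ℤtoℚ-+ (e m) (e n)) ⟨
    (c ℚ.* d) ℚ.* ℤtoℚ (e m ℤ.+ e n)
      ≡⟨ cong (λ k → (c ℚ.* d) ℚ.* ℤtoℚ k) (e-additive m n) ⟨
    (c ℚ.* d) ℚ.* w (m ·ₘ n)
      ∎
    where open ≡-Reasoning

  euler-◃ : ∀ c m q → euler e u ((c , m) ◃ q) ≋ (c ℚ.* w m , m ·ₘ u) ◃ q +ₚ (c , m) ◃ euler e u q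
  euler-◃ c m []            = ≋-refl
  euler-◃ c m ((d , n) ∷ q) = begin
    x ∷ euler e u ((c , m) ◃ q)
      ≈⟨ +-cong merged (≋-sym (euler-◃ c m q)) ⟨
    (y₁ ∷ y₂ ∷ []) +ₚ ((c ℚ.* w m , m ·ₘ u) ◃ q +ₚ (c , m) ◃ euler e u q)
      ≈⟨ interchange (y₁ ∷ []) (y₂ ∷ []) _ _ ⟩
    (y₁ ∷ (c ℚ.* w m , m ·ₘ u) ◃ q) +ₚ (y₂ ∷ (c , m) ◃ euler e u q)
      ∎
    where
    open ≋-Reasoning
    x y₁ y₂ : Term
    x  = ((c ℚ.* d) ℚ.* w (m ·ₘ n) , (m ·ₘ n) ·ₘ u)
    y₁ = ((c ℚ.* w m) ℚ.* d , (m ·ₘ u) ·ₘ n)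
    y₂ = (c ℚ.* (d ℚ.* w n) , m ·ₘ (n ·ₘ u))
    merged : y₁ ∷ y₂ ∷ [] ≋ x ∷ []
    merged = ≋-trans
      (≡⇒≋ (cong₂ (λ a b → (_ , a) ∷ (_ , b) ∷ [])
        (trans (·ₘ-assoc m u n) (trans (cong (m ·ₘ_) (·ₘ-comm u n)) (sym (·ₘ-assoc m n u))))
        (sym (·ₘ-assoc m n u))))
      (≋-trans (merge-terms _ _ _) (≡⇒≋ (cong (λ a → (a , _) ∷ []) (euler-coefficient c d m n))))

  euler-leibniz : ∀ p q → euler e u (p *ₚ q) ≋ euler e u p *ₚ q +ₚ p *ₚ euler e u q
  euler-leibniz []            q = ≋-refl
  euler-leibniz ((c , m) ∷ p) q = begin
    euler e u ((c , m) ◃ q +ₚ p *ₚ q)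
      ≡⟨ List.map-++ _ ((c , m) ◃ q) (p *ₚ q) ⟩
    euler e u ((c , m) ◃ q) +ₚ euler e u (p *ₚ q)
      ≈⟨ +-cong (euler-◃ c m q) (euler-leibniz p q) ⟩
    (t′ ◃ q +ₚ (c , m) ◃ euler e u q) +ₚ (euler e u p *ₚ q +ₚ p *ₚ euler e u q)
      ≈⟨ interchange (t′ ◃ q) ((c , m) ◃ euler e u q) (euler e u p *ₚ q) (p *ₚ euler e u q) ⟩
    (t′ ◃ q +ₚ euler e u p *ₚ q) +ₚ ((c , m) ◃ euler e u q +ₚ p *ₚ euler e u q)
      ∎
    where
    open ≋-Reasoning
    t′ : Term
    t′ = (c ℚ.* w m , m ·ₘ u)

  euler-isDerivation : IsDerivation (euler e u)
  euler-isDerivation = record { resp-≋ = shift-cong w u ; leibniz = euler-leibniz }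

zₘ yₘ xₘ xy/zₘ : Mono
zₘ    = mono (+ 0) (+ 0) (+ 0) (+ 1)
yₘ    = mono (+ 0) (+ 0) (+ 1) (+ 0)
xₘ    = mono (+ 0) (+ 1) (+ 0) (+ 0)
xy/zₘ = mono (+ 0) (+ 1) (+ 1) ℤ.-[1+ 0 ]

Euler-sum : Poly → Poly
Euler-sum p = euler Mono.ea zₘ p +ₚ (euler Mono.ex yₘ p +ₚ (euler Mono.ey xₘ p +ₚ euler Mono.ez xy/zₘ p))

D≋Euler-sum : ∀ p → D p ≋ Euler-sum p
D≋Euler-sum []      = ≋-refl
D≋Euler-sum (t ∷ p) = ≋-trans (+-congˡ (Dterm t) (D≋Euler-sum p))
  (regroup (euler Mono.ea zₘ (t ∷ [])) (euler Mono.ex yₘ (t ∷ [])) (euler Mono.ey xₘ (t ∷ [])) (euler Mono.ez xy/zₘ (t ∷ []))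
           (euler Mono.ea zₘ p) (euler Mono.ex yₘ p) (euler Mono.ey xₘ p) (euler Mono.ez xy/zₘ p))
  where
  regroup : ∀ a b c d A B C E → (a +ₚ (b +ₚ (c +ₚ d))) +ₚ (A +ₚ (B +ₚ (C +ₚ E))) ≋
                                (a +ₚ A) +ₚ ((b +ₚ B) +ₚ ((c +ₚ C) +ₚ (d +ₚ E)))
  regroup a b c d A B C E = ≋-trans (interchange a (b +ₚ (c +ₚ d)) A (B +ₚ (C +ₚ E)))
    (+-congˡ (a +ₚ A) (≋-trans (interchange b (c +ₚ d) B (C +ₚ E)) (+-congˡ (b +ₚ B) (interchange c d C E))))

D-isDerivation : IsDerivation D
D-isDerivation = isDerivation-resp (λ p → ≋-sym (D≋Euler-sum p))
  (+-isDerivation (euler-isDerivation Mono.ea zₘ (λ _ _ → refl))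
  (+-isDerivation (euler-isDerivation Mono.ex yₘ (λ _ _ → refl))
  (+-isDerivation (euler-isDerivation Mono.ey xₘ (λ _ _ → refl))
                  (euler-isDerivation Mono.ez xy/zₘ (λ _ _ → refl)))))

open IsDerivation D-isDerivation using () renaming (resp-≋ to D-cong; leibniz to D-leibniz)

D-+ : ∀ p q → D (p +ₚ q) ≡ D p +ₚ D q
D-+ = List.concatMap-++ Dterm

D-· : ∀ c p → D (c ·ₚ p) ≡ c ·ₚ D p
D-· c []            = refl
D-· c ((d , n) ∷ p) = trans (cong₂ _+ₚ_ Dterm-· (D-· c p)) (sym (·-distribˡ-+ c (Dterm (d , n)) (D p)))
  where
  Dterm-· : Dterm (c ℚ.* d , n) ≡ c ·ₚ Dterm (d , n)
  Dterm-· = cong₂ _∷_ (cong (_, _) (ℚP.*-assoc c d _)) (cong₂ _∷_ (cong (_, _) (ℚP.*-assoc c d _))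
           (cong₂ _∷_ (cong (_, _) (ℚP.*-assoc c d _)) (cong₂ _∷_ (cong (_, _) (ℚP.*-assoc c d _)) refl)))

-- Formal power series

infix 4 _≋ₛ_
_≋ₛ_ : PS → PS → Set
f ≋ₛ g = ∀ n → f n ≋ g n

≋ₛ-setoid : Setoid _ _
≋ₛ-setoid = record
  { Carrier = PS ; _≈_ = _≋ₛ_
  ; isEquivalence = record
    { refl = λ _ → ≋-refl ; sym = λ e n → ≋-sym (e n) ; trans = λ e f n → ≋-trans (e n) (f n) } }

module ≋ₛ-Reasoning = SetoidReasoning ≋ₛ-setoid

infixl 6 _+ₛ_
_+ₛ_ : PS → PS → PS
(f +ₛ g) n = f n +ₚ g n

infixl 7 _•ₛ_
_•ₛ_ : ℚ → PS → PS
(c •ₛ f) n = c ·ₚ f n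

constₛ : Poly → PS
constₛ p zero    = p
constₛ p (suc _) = zeroₚ

-- The Cauchy product _*ₛ_ rewritten by recursion on the degree, which suits induction.
infixl 7 _⊛_
_⊛_ : PS → PS → PS
(f ⊛ g) zero    = f 0 *ₚ g 0
(f ⊛ g) (suc n) = f 0 *ₚ g (suc n) +ₚ (f ∘ suc ⊛ g) n

*ₛ≋⊛ : ∀ f g → f *ₛ g ≋ₛ f ⊛ g
*ₛ≋⊛ f g n = ≋-trans (≡⇒≋ (cong sumₚ (List.map-upTo _ (suc n)))) (sum≋⊛ n f g)
  where
  sum≋⊛ : ∀ n f g → sumₚ (applyUpTo (λ k → f k *ₚ g (n ℕ.∸ k)) (suc n)) ≋ (f ⊛ g) n
  sum≋⊛ zero    f g = +-identityʳ (f 0 *ₚ g 0)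
  sum≋⊛ (suc n) f g = +-congˡ (f 0 *ₚ g (suc n)) (sum≋⊛ n (f ∘ suc) g)

⊛-cong : ∀ {f f′ g g′} → f ≋ₛ f′ → g ≋ₛ g′ → f ⊛ g ≋ₛ f′ ⊛ g′
⊛-cong f≋f′ g≋g′ zero    = *-cong (f≋f′ 0) (g≋g′ 0)
⊛-cong f≋f′ g≋g′ (suc n) = +-cong (*-cong (f≋f′ 0) (g≋g′ (suc n))) (⊛-cong (f≋f′ ∘ suc) g≋g′ n)

⊛-congˡ : ∀ f {g g′} → g ≋ₛ g′ → f ⊛ g ≋ₛ f ⊛ g′
⊛-congˡ f = ⊛-cong {f} (λ _ → ≋-refl)

⊛-congʳ : ∀ {f f′} g → f ≋ₛ f′ → f ⊛ g ≋ₛ f′ ⊛ g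
⊛-congʳ g f≋f′ = ⊛-cong f≋f′ (λ _ → ≋-refl {g _})

⊛-sucʳ : ∀ f g n → (f ⊛ g) (suc n) ≋ (f ⊛ g ∘ suc) n +ₚ f (suc n) *ₚ g 0
⊛-sucʳ f g zero    = ≋-refl
⊛-sucʳ f g (suc n) = ≋-trans (+-congˡ (f 0 *ₚ g (suc (suc n))) (⊛-sucʳ (f ∘ suc) g n))
  (≡⇒≋ (sym (List.++-assoc (f 0 *ₚ g (suc (suc n))) ((f ∘ suc ⊛ g ∘ suc) n) (f (suc (suc n)) *ₚ g 0))))

⊛-comm : ∀ f g → f ⊛ g ≋ₛ g ⊛ f
⊛-comm f g zero    = *-comm (f 0) (g 0)
⊛-comm f g (suc n) = begin
  f 0 *ₚ g (suc n) +ₚ (f ∘ suc ⊛ g) n    ≈⟨ +-cong (*-comm (f 0) (g (suc n))) (⊛-comm (f ∘ suc) g n) ⟩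
  g (suc n) *ₚ f 0 +ₚ (g ⊛ f ∘ suc) n    ≈⟨ +-comm (g (suc n) *ₚ f 0) ((g ⊛ f ∘ suc) n) ⟩
  (g ⊛ f ∘ suc) n +ₚ g (suc n) *ₚ f 0    ≈⟨ ⊛-sucʳ g f n ⟨
  (g ⊛ f) (suc n)                        ∎
  where open ≋-Reasoning

⊛-distribʳ-+ : ∀ f f′ g → (f +ₛ f′) ⊛ g ≋ₛ f ⊛ g +ₛ f′ ⊛ g
⊛-distribʳ-+ f f′ g zero    = ≡⇒≋ (*-distribʳ-+ (f 0) (f′ 0) (g 0))
⊛-distribʳ-+ f f′ g (suc n) = ≋-trans
  (+-cong (≡⇒≋ (*-distribʳ-+ (f 0) (f′ 0) (g (suc n)))) (⊛-distribʳ-+ (f ∘ suc) (f′ ∘ suc) g n))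
  (interchange (f 0 *ₚ g (suc n)) (f′ 0 *ₚ g (suc n)) ((f ∘ suc ⊛ g) n) ((f′ ∘ suc ⊛ g) n))

⊛-·ˡ : ∀ p f g → (p ·ₛ f) ⊛ g ≋ₛ p ·ₛ (f ⊛ g)
⊛-·ˡ p f g zero    = ≡⇒≋ (*-assoc p (f 0) (g 0))
⊛-·ˡ p f g (suc n) = ≋-trans (+-cong (≡⇒≋ (*-assoc p (f 0) (g (suc n)))) (⊛-·ˡ p (f ∘ suc) g n))
  (≋-sym (*-distribˡ-+ p (f 0 *ₚ g (suc n)) ((f ∘ suc ⊛ g) n)))

⊛-assoc : ∀ f g h → (f ⊛ g) ⊛ h ≋ₛ f ⊛ (g ⊛ h)
⊛-assoc f g h zero    = ≡⇒≋ (*-assoc (f 0) (g 0) (h 0))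
⊛-assoc f g h (suc n) = begin
  (f 0 *ₚ g 0) *ₚ h (suc n) +ₚ (((λ k → f 0 *ₚ g (suc k)) +ₛ (f ∘ suc ⊛ g)) ⊛ h) n
    ≈⟨ +-cong (≡⇒≋ (*-assoc (f 0) (g 0) (h (suc n))))
              (≋-trans (⊛-distribʳ-+ (λ k → f 0 *ₚ g (suc k)) (f ∘ suc ⊛ g) h n)
                       (+-cong (⊛-·ˡ (f 0) (g ∘ suc) h n) (⊛-assoc (f ∘ suc) g h n))) ⟩
  f 0 *ₚ (g 0 *ₚ h (suc n)) +ₚ (f 0 *ₚ (g ∘ suc ⊛ h) n +ₚ (f ∘ suc ⊛ (g ⊛ h)) n)
    ≡⟨ List.++-assoc (f 0 *ₚ (g 0 *ₚ h (suc n))) (f 0 *ₚ (g ∘ suc ⊛ h) n) ((f ∘ suc ⊛ (g ⊛ h)) n) ⟨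
  (f 0 *ₚ (g 0 *ₚ h (suc n)) +ₚ f 0 *ₚ (g ∘ suc ⊛ h) n) +ₚ (f ∘ suc ⊛ (g ⊛ h)) n
    ≈⟨ +-congʳ ((f ∘ suc ⊛ (g ⊛ h)) n) (*-distribˡ-+ (f 0) (g 0 *ₚ h (suc n)) ((g ∘ suc ⊛ h) n)) ⟨
  f 0 *ₚ (g ⊛ h) (suc n) +ₚ (f ∘ suc ⊛ (g ⊛ h)) n
    ∎
  where open ≋-Reasoning

⊛-commutativeSemigroup : CommutativeSemigroup _ _
⊛-commutativeSemigroup = record
  { Carrier = PS ; _≈_ = _≋ₛ_ ; _∙_ = _⊛_
  ; isCommutativeSemigroup = record
    { isSemigroup = record
      { isMagma = record { isEquivalence = Setoid.isEquivalence ≋ₛ-setoid ; ∙-cong = ⊛-cong }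
      ; assoc = ⊛-assoc }
    ; comm = ⊛-comm } }

open CommutativeSemigroupProperties ⊛-commutativeSemigroup using () renaming (interchange to ⊛-interchange)

⊛-•ˡ : ∀ c f g → (c •ₛ f) ⊛ g ≋ₛ c •ₛ (f ⊛ g)
⊛-•ˡ c f g zero    = *-·ˡ c (f 0) (g 0)
⊛-•ˡ c f g (suc n) = ≋-trans (+-cong (*-·ˡ c (f 0) (g (suc n))) (⊛-•ˡ c (f ∘ suc) g n))
  (≡⇒≋ (sym (·-distribˡ-+ c (f 0 *ₚ g (suc n)) ((f ∘ suc ⊛ g) n))))

⊛-distribʳ-- : ∀ f f′ g → (f -ₛ f′) ⊛ g ≋ₛ f ⊛ g -ₛ f′ ⊛ g
⊛-distribʳ-- f f′ g n = ≋-trans (⊛-distribʳ-+ f ((ℚ.- 1ℚ) •ₛ f′) g n)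
  (+-congˡ ((f ⊛ g) n) (⊛-•ˡ (ℚ.- 1ℚ) f′ g n))

⊛-distribˡ-- : ∀ f g g′ → f ⊛ (g -ₛ g′) ≋ₛ f ⊛ g -ₛ f ⊛ g′
⊛-distribˡ-- f g g′ n = ≋-trans (⊛-comm f (g -ₛ g′) n) (≋-trans (⊛-distribʳ-- g g′ f n)
  (+-cong (⊛-comm g f n) (·-cong (ℚ.- 1ℚ) (⊛-comm g′ f n))))

⊛-·ʳ : ∀ p f g → f ⊛ (p ·ₛ g) ≋ₛ p ·ₛ (f ⊛ g)
⊛-·ʳ p f g n = ≋-trans (⊛-comm f (p ·ₛ g) n) (≋-trans (⊛-·ˡ p g f n) (*-congˡ p (⊛-comm g f n)))

⊛-constˡ : ∀ p g → constₛ p ⊛ g ≋ₛ p ·ₛ g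
⊛-constˡ p g zero    = ≋-refl
⊛-constˡ p g (suc n) = ≋-trans (+-congˡ (p *ₚ g (suc n)) (⊛-zeroˡ n)) (+-identityʳ (p *ₚ g (suc n)))
  where
  ⊛-zeroˡ : ∀ n → ((λ _ → zeroₚ) ⊛ g) n ≋ zeroₚ
  ⊛-zeroˡ zero    = ≋-refl
  ⊛-zeroˡ (suc n) = ⊛-zeroˡ n

⊛-constʳ : ∀ p f → f ⊛ constₛ p ≋ₛ p ·ₛ f
⊛-constʳ p f n = ≋-trans (⊛-comm f (constₛ p) n) (⊛-constˡ p f n)

-- θ = t d/dt and ∂ = d/dt, acting on coefficient sequences.
θ ∂ : PS → PS
θ f n = ℕtoℚ n ·ₚ f n
∂ f n = ℕtoℚ (suc n) ·ₚ f (suc n)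

ℕtoℚ-suc-· : ∀ n p → ℕtoℚ (suc n) ·ₚ p ≋ ℕtoℚ n ·ₚ p +ₚ p
ℕtoℚ-suc-· n p = begin
  ℕtoℚ (suc n) ·ₚ p          ≡⟨ cong (_·ₚ p) (ℤtoℚ-+ (+ 1) (+ n)) ⟩
  (1ℚ ℚ.+ ℕtoℚ n) ·ₚ p       ≈⟨ ·-distribʳ-+ 1ℚ (ℕtoℚ n) p ⟩
  1ℚ ·ₚ p +ₚ ℕtoℚ n ·ₚ p     ≈⟨ +-comm (1ℚ ·ₚ p) (ℕtoℚ n ·ₚ p) ⟩
  ℕtoℚ n ·ₚ p +ₚ 1ℚ ·ₚ p     ≈⟨ +-congˡ (ℕtoℚ n ·ₚ p) (·-identityˡ p) ⟩
  ℕtoℚ n ·ₚ p +ₚ p           ∎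
  where open ≋-Reasoning

ℕtoℚ-suc-·-injective : ∀ n {p q} → ℕtoℚ (suc n) ·ₚ p ≋ ℕtoℚ (suc n) ·ₚ q → p ≋ q
ℕtoℚ-suc-·-injective n {p} {q} e = ≋-trans (cancel p) (≋-trans (·-cong (+ 1 ℚ./ suc n) e) (≋-sym (cancel q)))
  where
  cancel : ∀ r → r ≋ (+ 1 ℚ./ suc n) ·ₚ (ℕtoℚ (suc n) ·ₚ r)
  cancel r = ≋-sym (≋-trans (·-assoc (+ 1 ℚ./ suc n) (ℕtoℚ (suc n)) r) (≋-trans
    (≡⇒≋ (cong (_·ₚ r) (trans (ℚP.*-comm (+ 1 ℚ./ suc n) (ℕtoℚ (suc n)))
                              (ℕtoℚ-*-1/ (suc n) (suc n) 1 (ℕP.*-identityʳ (suc n))))))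
    (·-identityˡ r)))

-- The induction goes through for θ because θ f ∘ suc = ∂ f = θ (f ∘ suc) +ₛ f ∘ suc.
θ-⊛ : ∀ f g → θ (f ⊛ g) ≋ₛ θ f ⊛ g +ₛ f ⊛ θ g
θ-⊛ f g zero    = ≋-trans (·-zeroˡ (f 0 *ₚ g 0)) (≋-sym (+-cong (0·-*-zero (f 0) (g 0)) (*-0·-zero (f 0) (g 0))))
θ-⊛ f g (suc n) = begin
  ℕtoℚ (suc n) ·ₚ (C +ₚ B)
    ≡⟨ ·-distribˡ-+ (ℕtoℚ (suc n)) C B ⟩
  P +ₚ ℕtoℚ (suc n) ·ₚ B
    ≈⟨ +-congˡ P (ℕtoℚ-suc-· n B) ⟩
  P +ₚ (ℕtoℚ n ·ₚ B +ₚ B)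
    ≈⟨ +-congˡ P (+-congʳ B (θ-⊛ (f ∘ suc) g n)) ⟩
  P +ₚ ((A +ₚ E) +ₚ B)
    ≈⟨ rearrange P A E B ⟩
  (A +ₚ B) +ₚ (P +ₚ E)
    ≈⟨ +-cong (≋-trans (⊛-congʳ g (λ k → ℕtoℚ-suc-· k (f (suc k))) n) (⊛-distribʳ-+ (θ (f ∘ suc)) (f ∘ suc) g n))
              (+-congʳ E (*-·ʳ (ℕtoℚ (suc n)) (f 0) (g (suc n)))) ⟨
  (∂ f ⊛ g) n +ₚ (f 0 *ₚ ∂ g n +ₚ E)
    ≈⟨ +-congʳ _ (+-congʳ ((∂ f ⊛ g) n) (0·-*-zero (f 0) (g (suc n)))) ⟨
  (θ f ⊛ g) (suc n) +ₚ (f ⊛ θ g) (suc n)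
    ∎
  where
  open ≋-Reasoning
  C B A E P : Poly
  C = f 0 *ₚ g (suc n)
  B = (f ∘ suc ⊛ g) n
  A = (θ (f ∘ suc) ⊛ g) n
  E = (f ∘ suc ⊛ θ g) n
  P = ℕtoℚ (suc n) ·ₚ C
  rearrange : ∀ P A E B → P +ₚ ((A +ₚ E) +ₚ B) ≋ (A +ₚ B) +ₚ (P +ₚ E)
  rearrange = CM-solve 4 (λ P A E B → P ⊕ ((A ⊕ E) ⊕ B) ⊜ (A ⊕ B) ⊕ (P ⊕ E)) ≋-refl

∂-⊛ : ∀ f g → ∂ (f ⊛ g) ≋ₛ ∂ f ⊛ g +ₛ f ⊛ ∂ g
∂-⊛ f g n = ≋-trans (θ-⊛ f g (suc n)) (+-cong
  (+-congʳ ((∂ f ⊛ g) n) (0·-*-zero (f 0) (g (suc n))))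
  (≋-trans (⊛-sucʳ f (θ g) n) (≋-trans (+-congˡ ((f ⊛ ∂ g) n) (*-0·-zero (f (suc n)) (g 0)))
                                        (+-identityʳ ((f ⊛ ∂ g) n)))))

∂-unique : ∀ (φ : Poly → Poly) → (∀ {p q} → p ≋ q → φ p ≋ φ q) → ∀ {h h′} →
           ∂ h ≋ₛ φ ∘ h → ∂ h′ ≋ₛ φ ∘ h′ → h 0 ≋ h′ 0 → h ≋ₛ h′
∂-unique φ φ-cong ∂h≋φh ∂h′≋φh′ h₀≋h′₀ zero    = h₀≋h′₀
∂-unique φ φ-cong ∂h≋φh ∂h′≋φh′ h₀≋h′₀ (suc n) = ℕtoℚ-suc-·-injective n
  (≋-trans (∂h≋φh n) (≋-trans (φ-cong (∂-unique φ φ-cong ∂h≋φh ∂h′≋φh′ h₀≋h′₀ n)) (≋-sym (∂h′≋φh′ n))))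

-- Gen and the exponential series

D^-cong : ∀ n {p q} → p ≋ q → D^ n p ≋ D^ n q
D^-cong zero    p≋q = p≋q
D^-cong (suc n) p≋q = D-cong (D^-cong n p≋q)

D^-suc : ∀ n p → D^ (suc n) p ≡ D^ n (D p)
D^-suc zero    p = refl
D^-suc (suc n) p = cong D (D^-suc n p)

Gen-cong : ∀ {p q} → p ≋ q → Gen p ≋ₛ Gen q
Gen-cong p≋q n = ·-cong (1/fact n) (D^-cong n p≋q)

^-cong : ∀ n {p q} → p ≋ q → p ^ₚ n ≋ q ^ₚ n
^-cong zero    p≋q = ≋-refl
^-cong (suc n) p≋q = *-cong p≋q (^-cong n p≋q)

expS-cong : ∀ {p q} → p ≋ q → expS p ≋ₛ expS q
expS-cong p≋q n = ·-cong (1/fact n) (^-cong n p≋q)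

ℕtoℚ-suc-*-1/fact-suc : ∀ n → ℕtoℚ (suc n) ℚ.* 1/fact (suc n) ≡ 1/fact n
ℕtoℚ-suc-*-1/fact-suc n = ℕtoℚ-*-1/ (suc n) (suc n !) (n !) {{suc n ℕP.!≢0}} {{n ℕP.!≢0}} refl

∂-1/fact : ∀ n p → ℕtoℚ (suc n) ·ₚ (1/fact (suc n) ·ₚ p) ≋ 1/fact n ·ₚ p
∂-1/fact n p = ≋-trans (·-assoc (ℕtoℚ (suc n)) (1/fact (suc n)) p) (≡⇒≋ (cong (_·ₚ p) (ℕtoℚ-suc-*-1/fact-suc n)))

∂-Gen : ∀ w → ∂ (Gen w) ≋ₛ D ∘ Gen w
∂-Gen w n = ≋-trans (∂-1/fact n (D (D^ n w))) (≡⇒≋ (sym (D-· (1/fact n) (D^ n w))))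

∂-expS : ∀ s → ∂ (expS s) ≋ₛ s ·ₛ expS s
∂-expS s n = ≋-trans (∂-1/fact n (s *ₚ s ^ₚ n)) (≋-sym (*-·ʳ (1/fact n) s (s ^ₚ n)))

D-⊛ : ∀ f g → D ∘ (f ⊛ g) ≋ₛ (D ∘ f) ⊛ g +ₛ f ⊛ (D ∘ g)
D-⊛ f g zero    = D-leibniz (f 0) (g 0)
D-⊛ f g (suc n) = begin
  D (f 0 *ₚ g (suc n) +ₚ (f ∘ suc ⊛ g) n)
    ≡⟨ D-+ (f 0 *ₚ g (suc n)) ((f ∘ suc ⊛ g) n) ⟩
  D (f 0 *ₚ g (suc n)) +ₚ D ((f ∘ suc ⊛ g) n)
    ≈⟨ +-cong (D-leibniz (f 0) (g (suc n))) (D-⊛ (f ∘ suc) g n) ⟩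
  (D (f 0) *ₚ g (suc n) +ₚ f 0 *ₚ D (g (suc n))) +ₚ ((D ∘ f ∘ suc ⊛ g) n +ₚ (f ∘ suc ⊛ D ∘ g) n)
    ≈⟨ interchange (D (f 0) *ₚ g (suc n)) (f 0 *ₚ D (g (suc n))) ((D ∘ f ∘ suc ⊛ g) n) ((f ∘ suc ⊛ D ∘ g) n) ⟩
  ((D ∘ f) ⊛ g) (suc n) +ₚ (f ⊛ (D ∘ g)) (suc n)
    ∎
  where open ≋-Reasoning

Gen-* : ∀ u v → Gen (u *ₚ v) ≋ₛ Gen u ⊛ Gen v
Gen-* u v = ∂-unique D D-cong (∂-Gen (u *ₚ v)) ∂-Gen⊛Gen
  (≋-trans (·-identityˡ (u *ₚ v)) (≋-sym (*-cong (·-identityˡ u) (·-identityˡ v))))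
  where
  ∂-Gen⊛Gen : ∂ (Gen u ⊛ Gen v) ≋ₛ D ∘ (Gen u ⊛ Gen v)
  ∂-Gen⊛Gen n = ≋-trans (∂-⊛ (Gen u) (Gen v) n)
    (≋-trans (+-cong (⊛-congʳ (Gen v) (∂-Gen u) n) (⊛-congˡ (Gen u) (∂-Gen v) n)) (≋-sym (D-⊛ (Gen u) (Gen v) n)))

expS-+ : ∀ s r → expS s ⊛ expS r ≋ₛ expS (s +ₚ r)
expS-+ s r = ∂-unique ((s +ₚ r) *ₚ_) (*-congˡ (s +ₚ r)) ∂-expS⊛expS (∂-expS (s +ₚ r))
  (≋-trans (*-cong (·-identityˡ oneₚ) (·-identityˡ oneₚ)) (≋-trans (*-identityˡ oneₚ) (≋-sym (·-identityˡ oneₚ))))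
  where
  ∂-expS⊛expS : ∂ (expS s ⊛ expS r) ≋ₛ (s +ₚ r) ·ₛ (expS s ⊛ expS r)
  ∂-expS⊛expS n = begin
    ∂ (expS s ⊛ expS r) n
      ≈⟨ ∂-⊛ (expS s) (expS r) n ⟩
    (∂ (expS s) ⊛ expS r) n +ₚ (expS s ⊛ ∂ (expS r)) n
      ≈⟨ +-cong (⊛-congʳ (expS r) (∂-expS s) n) (⊛-congˡ (expS s) (∂-expS r) n) ⟩
    (s ·ₛ expS s ⊛ expS r) n +ₚ (expS s ⊛ (r ·ₛ expS r)) n
      ≈⟨ +-cong (⊛-·ˡ s (expS s) (expS r) n) (⊛-·ʳ r (expS s) (expS r) n) ⟩
    s *ₚ (expS s ⊛ expS r) n +ₚ r *ₚ (expS s ⊛ expS r) n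
      ≡⟨ *-distribʳ-+ s r ((expS s ⊛ expS r) n) ⟨
    (s +ₚ r) *ₚ (expS s ⊛ expS r) n
      ∎
    where open ≋-Reasoning

D-^-zero : ∀ {c} → D c ≋ zeroₚ → ∀ n → D (c ^ₚ n) ≋ zeroₚ
D-^-zero     Dc≋0 zero    = by-evaluation
D-^-zero {c} Dc≋0 (suc n) = ≋-trans (D-leibniz c (c ^ₚ n))
  (≋-trans (+-cong (*-congʳ (c ^ₚ n) Dc≋0) (*-congˡ c (D-^-zero Dc≋0 n))) (≡⇒≋ (*-zeroʳ c)))

Gen-eigenvector : ∀ {u c} → D u ≋ c *ₚ u → D c ≋ zeroₚ → Gen u ≋ₛ u ·ₛ expS c
Gen-eigenvector {u} {c} Du≋cu Dc≋0 = ∂-unique D D-cong (∂-Gen u) ∂-u·expS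
  (≋-trans (·-identityˡ u) (≋-sym (≋-trans (*-congˡ u (·-identityˡ oneₚ)) (*-identityʳ u))))
  where
  D-expS : ∀ n → D (expS c n) ≋ zeroₚ
  D-expS n = ≋-trans (≡⇒≋ (D-· (1/fact n) (c ^ₚ n))) (·-cong (1/fact n) (D-^-zero Dc≋0 n))
  ∂-u·expS : ∂ (u ·ₛ expS c) ≋ₛ D ∘ (u ·ₛ expS c)
  ∂-u·expS n = begin
    ℕtoℚ (suc n) ·ₚ (u *ₚ expS c (suc n))  ≈⟨ *-·ʳ (ℕtoℚ (suc n)) u (expS c (suc n)) ⟨
    u *ₚ ∂ (expS c) n                      ≈⟨ *-congˡ u (∂-expS c n) ⟩
    u *ₚ (c *ₚ expS c n)                   ≡⟨ *-assoc u c (expS c n) ⟨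
    (u *ₚ c) *ₚ expS c n                   ≈⟨ *-congʳ (expS c n) (≋-trans (*-comm u c) (≋-sym Du≋cu)) ⟩
    D u *ₚ expS c n                        ≈⟨ +-identityʳ (D u *ₚ expS c n) ⟨
    D u *ₚ expS c n +ₚ zeroₚ               ≈⟨ +-congˡ (D u *ₚ expS c n) (≋-trans (*-congˡ u (D-expS n)) (≡⇒≋ (*-zeroʳ u))) ⟨
    D u *ₚ expS c n +ₚ u *ₚ D (expS c n)   ≈⟨ D-leibniz u (expS c n) ⟨
    D (u *ₚ expS c n)                      ∎
    where open ≋-Reasoning

a/x y/x x-y z-y : Poly
a/x = (1ℚ , mono (+ 1) ℤ.-[1+ 0 ] (+ 0) (+ 0)) ∷ []
y/x = (1ℚ , mono (+ 0) ℤ.-[1+ 0 ] (+ 1) (+ 0)) ∷ []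
x-y = xP -ₚ yP
z-y = zP -ₚ yP

Gen-a : Gen aP ≋ₛ a/x ·ₛ expS z-y ⊛ Gen xP
Gen-a n = ≋-trans (Gen-cong (by-evaluation {aP} {a/x *ₚ xP}) n) (≋-trans (Gen-* a/x xP n)
  (⊛-congʳ (Gen xP) (Gen-eigenvector {a/x} {z-y} by-evaluation by-evaluation) n))

x·Gen-y : xP ·ₛ Gen yP ≋ₛ yP ·ₛ expS x-y ⊛ Gen xP
x·Gen-y n = begin
  xP *ₚ Gen yP n
    ≈⟨ *-congˡ xP (Gen-cong (by-evaluation {yP} {y/x *ₚ xP}) n) ⟩
  xP *ₚ Gen (y/x *ₚ xP) n
    ≈⟨ *-congˡ xP (Gen-* y/x xP n) ⟩
  xP *ₚ (Gen y/x ⊛ Gen xP) n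
    ≈⟨ *-congˡ xP (⊛-congʳ (Gen xP) (Gen-eigenvector {y/x} {x-y} by-evaluation by-evaluation) n) ⟩
  xP *ₚ (y/x ·ₛ expS x-y ⊛ Gen xP) n
    ≈⟨ ⊛-·ˡ xP (y/x ·ₛ expS x-y) (Gen xP) n ⟨
  ((λ k → xP *ₚ (y/x *ₚ expS x-y k)) ⊛ Gen xP) n
    ≈⟨ ⊛-congʳ (Gen xP) (λ k → ≋-trans (≡⇒≋ (sym (*-assoc xP y/x (expS x-y k))))
                                        (*-congʳ (expS x-y k) (by-evaluation {xP *ₚ y/x} {yP}))) n ⟩
  (yP ·ₛ expS x-y ⊛ Gen xP) n
    ∎
  where open ≋-Reasoning

Gen-x : Gen xP ≋ₛ Gen yP +ₛ constₛ x-y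
Gen-x zero    = by-evaluation
Gen-x (suc n) = ≋-sym (≋-trans (+-identityʳ (Gen yP (suc n))) (·-cong (1/fact (suc n))
  (≋-trans (≡⇒≋ (D^-suc n yP)) (≋-trans (D^-cong n (by-evaluation {D yP} {D xP})) (≡⇒≋ (sym (D^-suc n xP)))))))

K : PS
K = yP ·ₛ expS x-y -ₛ constₛ xP

K⊛Gen-x : K ⊛ Gen xP ≋ₛ constₛ (xP *ₚ (yP -ₚ xP))
K⊛Gen-x n = begin
  (K ⊛ Gen xP) n
    ≈⟨ ⊛-distribʳ-- (yP ·ₛ expS x-y) (constₛ xP) (Gen xP) n ⟩
  (yP ·ₛ expS x-y ⊛ Gen xP) n -ₚ (constₛ xP ⊛ Gen xP) n
    ≈⟨ +-cong (x·Gen-y n) (·-cong (ℚ.- 1ℚ) (≋-sym (⊛-constˡ xP (Gen xP) n))) ⟨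
  xP *ₚ Gen yP n -ₚ xP *ₚ Gen xP n
    ≈⟨ +-congˡ (xP *ₚ Gen yP n) (·-cong (ℚ.- 1ℚ)
         (≋-trans (*-congˡ xP (Gen-x n)) (*-distribˡ-+ xP (Gen yP n) (constₛ x-y n)))) ⟩
  xP *ₚ Gen yP n -ₚ (xP *ₚ Gen yP n +ₚ xP *ₚ constₛ x-y n)
    ≈⟨ -ₚ-+-cancel (xP *ₚ Gen yP n) (xP *ₚ constₛ x-y n) ⟩
  (ℚ.- 1ℚ) ·ₚ (xP *ₚ constₛ x-y n)
    ≈⟨ negate n ⟩
  constₛ (xP *ₚ (yP -ₚ xP)) n
    ∎
  where
  open ≋-Reasoning
  negate : ∀ n → (ℚ.- 1ℚ) ·ₚ (xP *ₚ constₛ x-y n) ≋ constₛ (xP *ₚ (yP -ₚ xP)) n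
  negate zero    = by-evaluation
  negate (suc n) = ≡⇒≋ (cong ((ℚ.- 1ℚ) ·ₚ_) (*-zeroʳ xP))

expS-difference≋expS-y⊛K : yP ·ₛ expS xP -ₛ xP ·ₛ expS yP ≋ₛ expS yP ⊛ K
expS-difference≋expS-y⊛K n = ≋-sym (≋-trans (⊛-distribˡ-- (expS yP) (yP ·ₛ expS x-y) (constₛ xP) n)
  (+-cong (≋-trans (⊛-·ʳ yP (expS yP) (expS x-y) n) (*-congˡ yP (≋-trans (expS-+ yP x-y n) (expS-cong by-evaluation n))))
          (·-cong (ℚ.- 1ℚ) (⊛-constʳ xP (expS yP) n))))

theorem2p2 : Gen aP *ₛ (yP ·ₛ expS xP -ₛ xP ·ₛ expS yP) ≈ₛ (aP *ₚ (yP -ₚ xP)) ·ₛ expS zP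
theorem2p2 n = coeff-≡ (main n)
  where
  open ≋ₛ-Reasoning
  main : Gen aP *ₛ (yP ·ₛ expS xP -ₛ xP ·ₛ expS yP) ≋ₛ (aP *ₚ (yP -ₚ xP)) ·ₛ expS zP
  main = begin
    Gen aP *ₛ (yP ·ₛ expS xP -ₛ xP ·ₛ expS yP)          ≈⟨ *ₛ≋⊛ (Gen aP) _ ⟩
    Gen aP ⊛ (yP ·ₛ expS xP -ₛ xP ·ₛ expS yP)           ≈⟨ ⊛-cong Gen-a expS-difference≋expS-y⊛K ⟩
    (a/x ·ₛ expS z-y ⊛ Gen xP) ⊛ (expS yP ⊛ K)          ≈⟨ ⊛-interchange (a/x ·ₛ expS z-y) (Gen xP) (expS yP) K ⟩
    (a/x ·ₛ expS z-y ⊛ expS yP) ⊛ (Gen xP ⊛ K)          ≈⟨ ⊛-cong expS-z (λ n → ≋-trans (⊛-comm (Gen xP) K n) (K⊛Gen-x n)) ⟩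
    a/x ·ₛ expS zP ⊛ constₛ (xP *ₚ (yP -ₚ xP))          ≈⟨ ⊛-constʳ (xP *ₚ (yP -ₚ xP)) (a/x ·ₛ expS zP) ⟩
    (xP *ₚ (yP -ₚ xP)) ·ₛ (a/x ·ₛ expS zP)              ≈⟨ regroup ⟩
    (aP *ₚ (yP -ₚ xP)) ·ₛ expS zP                       ∎
    where
    expS-z : a/x ·ₛ expS z-y ⊛ expS yP ≋ₛ a/x ·ₛ expS zP
    expS-z n = ≋-trans (⊛-·ˡ a/x (expS z-y) (expS yP) n) (*-congˡ a/x (≋-trans (expS-+ z-y yP n) (expS-cong by-evaluation n)))
    regroup : (xP *ₚ (yP -ₚ xP)) ·ₛ (a/x ·ₛ expS zP) ≋ₛ (aP *ₚ (yP -ₚ xP)) ·ₛ expS zP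
    regroup n = ≋-trans (≡⇒≋ (sym (*-assoc (xP *ₚ (yP -ₚ xP)) a/x (expS zP n)))) (*-congʳ (expS zP n) (by-evaluation {xP *ₚ (yP -ₚ xP) *ₚ a/x} {aP *ₚ (yP -ₚ xP)}))
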